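{- Let $n\ge 4$ and let $G$ be an optimal digraph on $n$ vertices. Then $\beta_G < n/2$.
   Context: Digraphs are finite and simple (no loops, no multiple edges); $2$-free means no distinct $u,v$ with both $uv,vu\in E(G)$. A circular interval digraph is a digraph whose vertices are arranged in a (fixed) circle such that for all distinct $u,v,w$ in clockwise order, $uw\in E(G)$ implies $uv,vw\in E(G)$. For distinct vertices $u,v$ let $d(u,v)=1+|\{w: u,w,v \text{ distinct, in clockwise order}\}|$; this is the length of the ordered pair $uv$. A non-edge is an ordered pair $uv$ of distinct vertices with $uv\notin E(G)$ and $vu\notin E(G)$; its length is $d(u,v)$. $\alpha_G$ is the least length of a non-edge ($\infty$ if there is none) and $\beta_G$ the greatest length of an edge ($0$ if there is none). $\tilde{P}_3(G)$ is the number of ordered triples $(u,w,v)$ of distinct vertices with $uw,wv\in E(G)$ and neither $uv$ nor $vu$ in $E(G)$. $\xi(G)$ is the number of pairs $(uv,wx)$ where $uv\in E(G)$, $wx$ is a non-edge and $d(u,v)>d(w,x)$. For fixed $n\ge 4$, a digraph $G$ is optimal if it is a $2$-free circular interval digraph on $n$ vertices which, among all $2$-free circular interval digraphs on $n$ vertices, maximizes $\tilde{P}_3$, and subject to this minimizes $\xi$. -}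

module Defs where

open import Data.Nat using (ℕ; zero; suc; _+_; _*_; _<_; _≤_; _⊔_; _<ᵇ_)
open import Data.Fin using (Fin; toℕ)
open import Data.Fin.Properties using (_≟_)
open import Data.Bool using (Bool; true; false; _∧_; _∨_; not; if_then_else_; T)
open import Relation.Nullary.Decidable using (⌊_⌋)
open import Relation.Binary.PropositionalEquality using (_≡_)
open import Data.Product using (_×_)

-- Vertices of a digraph on n vertices are Fin n; the fixed circle is the
-- order 0,1,...,n-1 clockwise (then back to 0).
-- A digraph is given by its adjacency predicate (Bool-valued, so that
-- all counts below are computable).
Digraph : ℕ → Set
Digraph n = Fin n → Fin n → Bool

count : ∀ {n} → (Fin n → Bool) → ℕ
count {zero}  p = 0
count {suc n} p = (if p Data.Fin.zero then 1 else 0) + count {n} (λ i → p (Data.Fin.suc i))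

sumOver : ∀ {n} → (Fin n → ℕ) → ℕ
sumOver {zero}  f = 0
sumOver {suc n} f = f Data.Fin.zero + sumOver {n} (λ i → f (Data.Fin.suc i))

maxOver : ∀ {n} → (Fin n → ℕ) → ℕ
maxOver {zero}  f = 0
maxOver {suc n} f = f Data.Fin.zero ⊔ maxOver {n} (λ i → f (Data.Fin.suc i))

neq : ∀ {n} → Fin n → Fin n → Bool
neq u v = not ⌊ u ≟ v ⌋

ltB : ∀ {n} → Fin n → Fin n → Bool
ltB u v = toℕ u <ᵇ toℕ v

clockwise : ∀ {n} → Fin n → Fin n → Fin n → Bool
clockwise u v w = (ltB u v ∧ ltB v w) ∨ (ltB v w ∧ ltB w u) ∨ (ltB w u ∧ ltB u v)

len : ∀ {n} → Fin n → Fin n → ℕ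
len u v = 1 + count (λ w → clockwise u w v)

Loopless : ∀ {n} → Digraph n → Set
Loopless G = ∀ u → G u u ≡ false

TwoFree : ∀ {n} → Digraph n → Set
TwoFree G = ∀ u v → T (neq u v) → T (G u v) → G v u ≡ false

CircularInterval : ∀ {n} → Digraph n → Set
CircularInterval G = ∀ u v w → T (clockwise u v w) → T (G u w) → T (G u v) × T (G v w)

Admissible : ∀ {n} → Digraph n → Set
Admissible G = Loopless G × TwoFree G × CircularInterval G

nonEdge : ∀ {n} → Digraph n → Fin n → Fin n → Bool
nonEdge G u v = neq u v ∧ not (G u v) ∧ not (G v u)

-- β_G : greatest length of an edge (0 if none)
β : ∀ {n} → Digraph n → ℕ
β G = maxOver (λ u → maxOver (λ v → if G u v then len u v else 0))

P3 : ∀ {n} → Digraph n → ℕ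
P3 G = sumOver λ u → sumOver λ w → count λ v →
  neq u w ∧ neq w v ∧ neq u v ∧ G u w ∧ G w v ∧ not (G u v) ∧ not (G v u)

ξ : ∀ {n} → Digraph n → ℕ
ξ G = sumOver λ u → sumOver λ v → sumOver λ w → count λ x →
  G u v ∧ nonEdge G w x ∧ (len w x <ᵇ len u v)

Optimal : ∀ {n} → Digraph n → Set
Optimal {n} G =
  Admissible G ×
  (∀ (H : Digraph n) → Admissible H → P3 H ≤ P3 G) ×
  (∀ (H : Digraph n) → Admissible H → P3 H ≡ P3 G → ξ G ≤ ξ H)

module Submission where

-- Suppose 2 β_G ≥ n and let uv be an edge of maximal length β_G.  Deleting
-- uv gives a digraph H that is still a 2-free circular interval digraph
-- (the interval condition never needs a longest edge).  Comparing P̃₃: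
--   * each vertex w strictly inside the arc u→v yields a new induced path
--     u→w→v of H, so len(u,v) − 1 paths are created;
--   * the only induced paths of G that disappear use the edge uv, i.e. are
--     u→v→w or w→u→v, and then w lies strictly inside the arc v→u, so at
--     most len(v,u) − 1 paths are lost.
-- As len(u,v) + len(v,u) = n ≤ 2 len(u,v), H has at least as many induced
-- paths as G; by optimality all these inequalities are equalities.  Hence
-- len(u,v) = len(v,u) and some path is lost; its two ends form a non-edge
-- of G shorter than uv.  That non-edge makes ξ(H) < ξ(G), whereas
-- optimality forces ξ(G) ≤ ξ(H).

open import Defs
open import Data.Nat using (ℕ; zero; suc; _+_; _*_; _≤_; _<_; z≤n; s≤s; z<s; _<ᵇ_)
open import Data.Nat.Properties
  using ( ≤-refl; ≤-trans; ≤-antisym; ≤-pred; <-≤-trans; <-trans; <-asym; <-irrefl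
        ; <-cmp; <⇒≱; ≰⇒>; <ᵇ⇒<; <⇒<ᵇ; m≤m+n; m≤n+m; m≤n⇒m≤o⊔n; m≤m⊔n; ⊔-sel
        ; +-identityʳ; +-mono-≤; +-mono-<-≤; +-mono-≤-<; +-monoˡ-≤; +-monoʳ-≤
        ; +-cancelˡ-≤; +-cancelʳ-≤; *-cancelˡ-≤; +-commutativeSemigroup
        ; module ≤-Reasoning )
open import Algebra.Properties.CommutativeSemigroup +-commutativeSemigroup using (interchange)
open import Data.Fin using (Fin; toℕ) renaming (zero to fzero; suc to fsuc)
open import Data.Fin.Properties using (_≟_; toℕ-injective; suc-injective)
open import Data.Bool using (Bool; true; false; _∧_; _∨_; not; if_then_else_; T)
open import Data.Bool.Properties using (T-∧; T-∨)
open import Data.Product using (_×_; _,_; proj₁; proj₂; ∃; ∃₂)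
open import Data.Sum using (_⊎_; inj₁; inj₂)
open import Data.Unit using (tt)
open import Data.Empty using (⊥; ⊥-elim)
open import Function using (_∘_)
open import Function.Bundles using (Equivalence)
open import Relation.Nullary using (¬_; yes; no)
open import Relation.Nullary.Decidable
  using (⌊_⌋; toWitness; fromWitness; toWitnessFalse; fromWitnessFalse)
open import Relation.Binary.Definitions using (tri<; tri≈; tri>)
open import Relation.Binary.PropositionalEquality
  using (_≡_; _≢_; refl; sym; trans; cong; cong₂; subst; subst₂; module ≡-Reasoning)

open Equivalence using (to; from)

-- Finite sums and counts over Fin n.

ind : Bool → ℕ
ind b = if b then 1 else 0

δ : ∀ {n} → Fin n → Fin n → ℕ → ℕ
δ u a x = if ⌊ a ≟ u ⌋ then x else 0

Σ3 : ∀ {n} → (Fin n → Fin n → Fin n → ℕ) → ℕ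
Σ3 f = sumOver λ a → sumOver λ b → sumOver λ c → f a b c

count-as-sum : ∀ {n} (p : Fin n → Bool) → count p ≡ sumOver (λ i → ind (p i))
count-as-sum {zero}  p = refl
count-as-sum {suc n} p = cong (ind (p fzero) +_) (count-as-sum (λ i → p (fsuc i)))

sum-cong : ∀ {n} {f g : Fin n → ℕ} → (∀ i → f i ≡ g i) → sumOver f ≡ sumOver g
sum-cong {zero}  e = refl
sum-cong {suc n} e = cong₂ _+_ (e fzero) (sum-cong (λ i → e (fsuc i)))

sum-mono : ∀ {n} {f g : Fin n → ℕ} → (∀ i → f i ≤ g i) → sumOver f ≤ sumOver g
sum-mono {zero}  le = z≤n
sum-mono {suc n} le = +-mono-≤ (le fzero) (sum-mono (λ i → le (fsuc i)))

sum-strict : ∀ {n} {f g : Fin n → ℕ} → (∀ i → f i ≤ g i) →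
             ∀ j → f j < g j → sumOver f < sumOver g
sum-strict {suc n} le fzero    lt = +-mono-<-≤ lt (sum-mono (λ i → le (fsuc i)))
sum-strict {suc n} le (fsuc j) lt = +-mono-≤-< (le fzero) (sum-strict (λ i → le (fsuc i)) j lt)

sum-+ : ∀ {n} (f g : Fin n → ℕ) → sumOver (λ i → f i + g i) ≡ sumOver f + sumOver g
sum-+ {zero}  f g = refl
sum-+ {suc n} f g =
  trans (cong (f fzero + g fzero +_) (sum-+ (λ i → f (fsuc i)) (λ i → g (fsuc i))))
        (interchange (f fzero) (g fzero) _ _)

sum-zeros : ∀ {n} → sumOver {n} (λ _ → 0) ≡ 0
sum-zeros {zero}  = refl
sum-zeros {suc n} = sum-zeros {n}

sum-ones : ∀ {n} → sumOver {n} (λ _ → 1) ≡ n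
sum-ones {zero}  = refl
sum-ones {suc n} = cong suc (sum-ones {n})

sum-point : ∀ {n} (u : Fin n) (g : Fin n → ℕ) → (∀ a → a ≢ u → g a ≡ 0) → sumOver g ≡ g u
sum-point {suc n} fzero g off =
  trans (cong (g fzero +_) (trans (sum-cong (λ i → off (fsuc i) λ ())) (sum-zeros {n})))
        (+-identityʳ (g fzero))
sum-point {suc n} (fsuc u) g off =
  trans (cong (_+ sumOver (λ i → g (fsuc i))) (off fzero λ ()))
        (sum-point u (λ i → g (fsuc i)) (λ i i≢u → off (fsuc i) (i≢u ∘ suc-injective)))

δ-here : ∀ {n} (u : Fin n) x → δ u u x ≡ x
δ-here u x with u ≟ u
... | yes _   = refl
... | no  u≢u = ⊥-elim (u≢u refl)

δ-elsewhere : ∀ {n} {u a : Fin n} x → a ≢ u → δ u a x ≡ 0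
δ-elsewhere {u = u} {a} x a≢u with a ≟ u
... | yes a≡u = ⊥-elim (a≢u a≡u)
... | no  _   = refl

sum-δ : ∀ {n} (u : Fin n) (f : Fin n → ℕ) → sumOver (λ a → δ u a (f a)) ≡ f u
sum-δ u f = trans (sum-point u _ (λ a → δ-elsewhere (f a))) (δ-here u (f u))

δ-sum : ∀ {n m} (u a : Fin n) (f : Fin m → ℕ) → sumOver (λ b → δ u a (f b)) ≡ δ u a (sumOver f)
δ-sum {m = m} u a f with a ≟ u
... | yes _ = refl
... | no  _ = sum-zeros {m}

Σ3-+ : ∀ {n} (f g : Fin n → Fin n → Fin n → ℕ) →
       Σ3 (λ a b c → f a b c + g a b c) ≡ Σ3 f + Σ3 g
Σ3-+ f g =
  trans (sum-cong λ a → trans (sum-cong λ b → sum-+ (f a b) (g a b))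
                              (sum-+ (λ b → sumOver (f a b)) (λ b → sumOver (g a b))))
        (sum-+ (λ a → sumOver λ b → sumOver (f a b)) (λ a → sumOver λ b → sumOver (g a b)))

Σ3-mono : ∀ {n} {f g : Fin n → Fin n → Fin n → ℕ} →
          (∀ a b c → f a b c ≤ g a b c) → Σ3 f ≤ Σ3 g
Σ3-mono le = sum-mono λ a → sum-mono λ b → sum-mono λ c → le a b c

Σ3-strict : ∀ {n} {f g : Fin n → Fin n → Fin n → ℕ} → (∀ a b c → f a b c ≤ g a b c) →
            ∀ a b c → f a b c < g a b c → Σ3 f < Σ3 g
Σ3-strict le a b c lt =
  sum-strict (λ a → sum-mono λ b → sum-mono (le a b)) a
    (sum-strict (λ b → sum-mono (le a b)) b (sum-strict (le a b) c lt))

Σ3-δ₁₃ : ∀ {n} (u v : Fin n) (g : Fin n → Fin n → Fin n → ℕ) →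
         Σ3 (λ a b c → δ u a (δ v c (g a b c))) ≡ sumOver (λ b → g u b v)
Σ3-δ₁₃ u v g = begin
    Σ3 (λ a b c → δ u a (δ v c (g a b c)))
  ≡⟨ sum-cong (λ a → sum-cong λ b →
       trans (δ-sum u a (λ c → δ v c (g a b c))) (cong (δ u a) (sum-δ v (g a b)))) ⟩
    sumOver (λ a → sumOver λ b → δ u a (g a b v))
  ≡⟨ sum-cong (λ a → δ-sum u a (λ b → g a b v)) ⟩
    sumOver (λ a → δ u a (sumOver λ b → g a b v))
  ≡⟨ sum-δ u (λ a → sumOver λ b → g a b v) ⟩
    sumOver (λ b → g u b v) ∎
  where open ≡-Reasoning

Σ3-δ₁₂ : ∀ {n} (u v : Fin n) (g : Fin n → Fin n → Fin n → ℕ) →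
         Σ3 (λ a b c → δ u a (δ v b (g a b c))) ≡ sumOver (λ c → g u v c)
Σ3-δ₁₂ u v g = begin
    Σ3 (λ a b c → δ u a (δ v b (g a b c)))
  ≡⟨ sum-cong (λ a → sum-cong λ b →
       trans (δ-sum u a (λ c → δ v b (g a b c))) (cong (δ u a) (δ-sum v b (g a b)))) ⟩
    sumOver (λ a → sumOver λ b → δ u a (δ v b (sumOver (g a b))))
  ≡⟨ sum-cong (λ a →
       trans (δ-sum u a (λ b → δ v b (sumOver (g a b))))
             (cong (δ u a) (sum-δ v (λ b → sumOver (g a b))))) ⟩
    sumOver (λ a → δ u a (sumOver (g a v)))
  ≡⟨ sum-δ u (λ a → sumOver (g a v)) ⟩
    sumOver (λ c → g u v c) ∎
  where open ≡-Reasoning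

Σ3-δ₂₃ : ∀ {n} (u v : Fin n) (g : Fin n → Fin n → Fin n → ℕ) →
         Σ3 (λ a b c → δ u b (δ v c (g a b c))) ≡ sumOver (λ a → g a u v)
Σ3-δ₂₃ u v g = begin
    Σ3 (λ a b c → δ u b (δ v c (g a b c)))
  ≡⟨ sum-cong (λ a → sum-cong λ b →
       trans (δ-sum u b (λ c → δ v c (g a b c))) (cong (δ u b) (sum-δ v (g a b)))) ⟩
    sumOver (λ a → sumOver λ b → δ u b (g a b v))
  ≡⟨ sum-cong (λ a → sum-δ u (λ b → g a b v)) ⟩
    sumOver (λ a → g a u v) ∎
  where open ≡-Reasoning

ind-mono : ∀ {p q} → (T p → T q) → ind p ≤ ind q
ind-mono {false}         _   = z≤n
ind-mono {true}  {true}  _   = ≤-refl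
ind-mono {true}  {false} p⇒q = ⊥-elim (p⇒q tt)

ind-strict : ∀ {p q} → ¬ T p → T q → ind p < ind q
ind-strict {false} {true} _  _ = s≤s z≤n
ind-strict {true}         ¬p _ = ⊥-elim (¬p tt)

ind-disjoint : ∀ {p q r} → (T p → T r) → (T q → T r) → (T p → T q → ⊥) → ind p + ind q ≤ ind r
ind-disjoint {false} {false} _   _   _    = z≤n
ind-disjoint {true}  {true}  _   _   disj = ⊥-elim (disj tt tt)
ind-disjoint {true}  {false} p⇒r _   _    = ind-mono {true} p⇒r
ind-disjoint {false} {true}  _   q⇒r _    = ind-mono {true} q⇒r

count-mono : ∀ {n} {p q : Fin n → Bool} → (∀ i → T (p i) → T (q i)) → count p ≤ count q
count-mono {p = p} {q} p⇒q =
  subst₂ _≤_ (sym (count-as-sum p)) (sym (count-as-sum q)) (sum-mono (λ i → ind-mono (p⇒q i)))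

count-strict : ∀ {n} {p q : Fin n → Bool} → (∀ i → T (p i) → T (q i)) →
               ∀ j → ¬ T (p j) → T (q j) → count p < count q
count-strict {p = p} {q} p⇒q j ¬pj qj =
  subst₂ _<_ (sym (count-as-sum p)) (sym (count-as-sum q))
    (sum-strict (λ i → ind-mono (p⇒q i)) j (ind-strict ¬pj qj))

count-disjoint : ∀ {n} {p q r : Fin n → Bool} →
                 (∀ i → T (p i) → T (r i)) → (∀ i → T (q i) → T (r i)) →
                 (∀ i → T (p i) → T (q i) → ⊥) → count p + count q ≤ count r
count-disjoint {p = p} {q} {r} p⇒r q⇒r disj = begin
    count p + count q
  ≡⟨ cong₂ _+_ (count-as-sum p) (count-as-sum q) ⟩
    sumOver (λ i → ind (p i)) + sumOver (λ i → ind (q i))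
  ≡⟨ sum-+ (λ i → ind (p i)) (λ i → ind (q i)) ⟨
    sumOver (λ i → ind (p i) + ind (q i))
  ≤⟨ sum-mono (λ i → ind-disjoint (p⇒r i) (q⇒r i) (disj i)) ⟩
    sumOver (λ i → ind (r i))
  ≡⟨ count-as-sum r ⟨
    count r ∎
  where open ≤-Reasoning

count-witness : ∀ {n} (p : Fin n → Bool) → 0 < count p → ∃ λ i → T (p i)
count-witness {suc n} p pos with p fzero in eq
... | true  = fzero , subst T (sym eq) tt
... | false = let (i , pi) = count-witness (λ i → p (fsuc i)) pos in fsuc i , pi

max-ub : ∀ {n} (f : Fin n → ℕ) i → f i ≤ maxOver f
max-ub f fzero    = m≤m⊔n _ _
max-ub f (fsuc i) = m≤n⇒m≤o⊔n (f fzero) (max-ub (λ j → f (fsuc j)) i)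

max-attained : ∀ {n} (f : Fin n → ℕ) → 0 < maxOver f → ∃ λ i → f i ≡ maxOver f
max-attained {suc n} f pos with ⊔-sel (f fzero) (maxOver (λ j → f (fsuc j)))
... | inj₁ e = fzero , sym e
... | inj₂ e =
  let (i , fi≡max) = max-attained (λ j → f (fsuc j)) (subst (0 <_) e pos) in fsuc i , trans fi≡max (sym e)

∧⁻ : ∀ x {y} → T (x ∧ y) → T x × T y
∧⁻ x = to (T-∧ {x})

∧⁺ : ∀ {x y} → T x → T y → T (x ∧ y)
∧⁺ p q = from T-∧ (p , q)

∨⁻ : ∀ x {y} → T (x ∨ y) → T x ⊎ T y
∨⁻ x = to (T-∨ {x})

T-not⁻ : ∀ x → T (not x) → ¬ T x
T-not⁻ false _ ()

T-not⁺ : ∀ {x} → ¬ T x → T (not x)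
T-not⁺ {false} _  = tt
T-not⁺ {true}  ¬x = ¬x tt

ind-true : ∀ {x} → T x → ind x ≡ 1
ind-true {true} _ = refl

ind-false : ∀ {x} → ¬ T x → ind x ≡ 0
ind-false {false} _  = refl
ind-false {true}  ¬x = ⊥-elim (¬x tt)

neq⁻ : ∀ {n} (a b : Fin n) → T (neq a b) → a ≢ b
neq⁻ a b = toWitnessFalse {a? = a ≟ b}

neq⁺ : ∀ {n} {a b : Fin n} → a ≢ b → T (neq a b)
neq⁺ {a = a} {b} = fromWitnessFalse {a? = a ≟ b}

nonEdge⁻ : ∀ {n} (K : Digraph n) a b → T (nonEdge K a b) → a ≢ b × ¬ T (K a b) × ¬ T (K b a)
nonEdge⁻ K a b t =
  let (a≢b , t₁) = ∧⁻ (neq a b) t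
      (¬ab , ¬ba) = ∧⁻ (not (K a b)) t₁
  in neq⁻ a b a≢b , T-not⁻ (K a b) ¬ab , T-not⁻ (K b a) ¬ba

nonEdge⁺ : ∀ {n} (K : Digraph n) {a b} → a ≢ b → ¬ T (K a b) → ¬ T (K b a) → T (nonEdge K a b)
nonEdge⁺ K a≢b ¬ab ¬ba = ∧⁺ (neq⁺ a≢b) (∧⁺ (T-not⁺ ¬ab) (T-not⁺ ¬ba))

path? : ∀ {n} → Digraph n → Fin n → Fin n → Fin n → Bool
path? K a b c = neq a b ∧ neq b c ∧ neq a c ∧ K a b ∧ K b c ∧ not (K a c) ∧ not (K c a)

record Path3 {n} (K : Digraph n) (a b c : Fin n) : Set where
  field
    a≢b : a ≢ b
    b≢c : b ≢ c
    a≢c : a ≢ c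
    ab  : T (K a b)
    bc  : T (K b c)
    ¬ac : ¬ T (K a c)
    ¬ca : ¬ T (K c a)

path-sound : ∀ {n} (K : Digraph n) a b c → T (path? K a b c) → Path3 K a b c
path-sound K a b c t =
  let (a≢b , t₁) = ∧⁻ (neq a b) t
      (b≢c , t₂) = ∧⁻ (neq b c) t₁
      (a≢c , t₃) = ∧⁻ (neq a c) t₂
      (ab  , t₄) = ∧⁻ (K a b) t₃
      (bc  , t₅) = ∧⁻ (K b c) t₄
      (¬ac , ¬ca) = ∧⁻ (not (K a c)) t₅
  in record { a≢b = neq⁻ a b a≢b ; b≢c = neq⁻ b c b≢c ; a≢c = neq⁻ a c a≢c
            ; ab = ab ; bc = bc ; ¬ac = T-not⁻ (K a c) ¬ac ; ¬ca = T-not⁻ (K c a) ¬ca }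

path-complete : ∀ {n} {K : Digraph n} {a b c} → Path3 K a b c → T (path? K a b c)
path-complete P =
  ∧⁺ (neq⁺ a≢b) (∧⁺ (neq⁺ b≢c) (∧⁺ (neq⁺ a≢c)
    (∧⁺ ab (∧⁺ bc (∧⁺ (T-not⁺ ¬ac) (T-not⁺ ¬ca))))))
  where open Path3 P

shorter? : ∀ {n} → Digraph n → Fin n → Fin n → Fin n → Fin n → Bool
shorter? K a b c d = K a b ∧ nonEdge K c d ∧ (len c d <ᵇ len a b)

P3-as-Σ3 : ∀ {n} (K : Digraph n) → P3 K ≡ Σ3 (λ a b c → ind (path? K a b c))
P3-as-Σ3 K = sum-cong λ a → sum-cong λ b → count-as-sum (path? K a b)

-- The circular order on Fin n.

data Clockwise {n} (a b c : Fin n) : Set where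
  abc : toℕ a < toℕ b → toℕ b < toℕ c → Clockwise a b c
  bca : toℕ b < toℕ c → toℕ c < toℕ a → Clockwise a b c
  cab : toℕ c < toℕ a → toℕ a < toℕ b → Clockwise a b c

clockwise-sound : ∀ {n} (a b c : Fin n) → T (clockwise a b c) → Clockwise a b c
clockwise-sound a b c t with ∨⁻ (ltB a b ∧ ltB b c) t
... | inj₁ t₁ = let (p , q) = ∧⁻ (ltB a b) t₁ in abc (<ᵇ⇒< _ _ p) (<ᵇ⇒< _ _ q)
... | inj₂ t₂ with ∨⁻ (ltB b c ∧ ltB c a) t₂
...   | inj₁ t₃ = let (p , q) = ∧⁻ (ltB b c) t₃ in bca (<ᵇ⇒< _ _ p) (<ᵇ⇒< _ _ q)
...   | inj₂ t₄ = let (p , q) = ∧⁻ (ltB c a) t₄ in cab (<ᵇ⇒< _ _ p) (<ᵇ⇒< _ _ q)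

clockwise-complete : ∀ {n} {a b c : Fin n} → Clockwise a b c → T (clockwise a b c)
clockwise-complete {a = a} {b} {c} (abc p q) =
  from (T-∨ {ltB a b ∧ ltB b c}) (inj₁ (∧⁺ (<⇒<ᵇ p) (<⇒<ᵇ q)))
clockwise-complete {a = a} {b} {c} (bca p q) =
  from (T-∨ {ltB a b ∧ ltB b c})
    (inj₂ (from (T-∨ {ltB b c ∧ ltB c a}) (inj₁ (∧⁺ (<⇒<ᵇ p) (<⇒<ᵇ q)))))
clockwise-complete {a = a} {b} {c} (cab p q) =
  from (T-∨ {ltB a b ∧ ltB b c})
    (inj₂ (from (T-∨ {ltB b c ∧ ltB c a}) (inj₂ (∧⁺ (<⇒<ᵇ p) (<⇒<ᵇ q)))))

cw-rotate : ∀ {n} {a b c : Fin n} → Clockwise a b c → Clockwise b c a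
cw-rotate (abc p q) = cab p q
cw-rotate (bca p q) = abc p q
cw-rotate (cab p q) = bca p q

cw-distinct : ∀ {n} {a b c : Fin n} → Clockwise a b c → a ≢ b
cw-distinct (abc p _) refl = <-irrefl refl p
cw-distinct (bca p q) refl = <-asym p q
cw-distinct (cab _ q) refl = <-irrefl refl q

cw-distinct₂ : ∀ {n} {a b c : Fin n} → Clockwise a b c → b ≢ c
cw-distinct₂ = cw-distinct ∘ cw-rotate

cw-exclusive : ∀ {n} {a b c : Fin n} → Clockwise a b c → Clockwise c b a → ⊥
cw-exclusive (abc ab _ ) (abc _  ba) = <-asym ab ba
cw-exclusive (abc ab _ ) (bca ba _ ) = <-asym ab ba
cw-exclusive (abc _  bc) (cab _  cb) = <-asym bc cb
cw-exclusive (bca bc _ ) (abc cb _ ) = <-asym bc cb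
cw-exclusive (bca _  ca) (bca _  ac) = <-asym ca ac
cw-exclusive (bca _  ca) (cab ac _ ) = <-asym ca ac
cw-exclusive (cab _  ab) (abc _  ba) = <-asym ab ba
cw-exclusive (cab ca _ ) (bca _  ac) = <-asym ca ac
cw-exclusive (cab ca _ ) (cab ac _ ) = <-asym ca ac

cw-total : ∀ {n} {a b c : Fin n} → a ≢ b → b ≢ c → c ≢ a → Clockwise a b c ⊎ Clockwise c b a
cw-total {a = a} {b} {c} a≢b b≢c c≢a
  with <-cmp (toℕ a) (toℕ b) | <-cmp (toℕ b) (toℕ c) | <-cmp (toℕ c) (toℕ a)
... | tri≈ _ e _ | _          | _          = ⊥-elim (a≢b (toℕ-injective e))
... | _          | tri≈ _ e _ | _          = ⊥-elim (b≢c (toℕ-injective e))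
... | _          | _          | tri≈ _ e _ = ⊥-elim (c≢a (toℕ-injective e))
... | tri< ab _ _ | tri< bc _ _ | _           = inj₁ (abc ab bc)
... | tri< ab _ _ | tri> _ _ cb | tri< ca _ _ = inj₁ (cab ca ab)
... | tri< _ _ _  | tri> _ _ cb | tri> _ _ ac = inj₂ (cab ac cb)
... | tri> _ _ _  | tri< bc _ _ | tri< ca _ _ = inj₁ (bca bc ca)
... | tri> _ _ ba | tri< _ _ _  | tri> _ _ ac = inj₂ (bca ba ac)
... | tri> _ _ ba | tri> _ _ cb | _           = inj₂ (abc cb ba)

cw-trans : ∀ {n} {p a b c : Fin n} → Clockwise p a b → Clockwise p b c → Clockwise p a c
cw-trans (abc pa ab) (abc _  bc) = abc pa (<-trans ab bc)
cw-trans (abc pa ab) (bca bc cp) = ⊥-elim (<-asym (<-trans pa ab) (<-trans bc cp))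
cw-trans (abc pa _ ) (cab cp _ ) = cab cp pa
cw-trans (bca _  bp) (abc pb _ ) = ⊥-elim (<-asym bp pb)
cw-trans (bca ab _ ) (bca bc cp) = bca (<-trans ab bc) cp
cw-trans (bca _  bp) (cab _  pb) = ⊥-elim (<-asym bp pb)
cw-trans (cab bp _ ) (abc pb _ ) = ⊥-elim (<-asym bp pb)
cw-trans (cab _  pa) (bca _  cp) = cab cp pa
cw-trans (cab bp _ ) (cab _  pb) = ⊥-elim (<-asym bp pb)

arc-shrink-end : ∀ {n} {a b c z : Fin n} → Clockwise a b c → Clockwise a z b → Clockwise a z c
arc-shrink-end abc′ azb = cw-trans azb abc′

arc-shrink-start : ∀ {n} {a b c z : Fin n} → Clockwise a b c → Clockwise b z c → Clockwise a z c
arc-shrink-start abc′ bzc =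
  cw-rotate (cw-trans (cw-rotate (cw-rotate abc′)) (cw-rotate (cw-rotate bzc)))

inner : ∀ {n} → Fin n → Fin n → ℕ
inner a b = count (λ z → clockwise a z b)

len-mono-end : ∀ {n} {a b c : Fin n} → Clockwise a b c → len a b < len a c
len-mono-end {a = a} {b} {c} cw =
  s≤s (count-strict (λ z t → clockwise-complete (arc-shrink-end cw (clockwise-sound a z b t)))
                    b (λ t → cw-distinct₂ (clockwise-sound a b b t) refl) (clockwise-complete cw))

len-mono-start : ∀ {n} {a b c : Fin n} → Clockwise a b c → len b c < len a c
len-mono-start {a = a} {b} {c} cw =
  s≤s (count-strict (λ z t → clockwise-complete (arc-shrink-start cw (clockwise-sound b z c t)))
                    b (λ t → cw-distinct (clockwise-sound b b c t) refl) (clockwise-complete cw))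

len-as-sum : ∀ {n} (a b : Fin n) → len a b ≡ sumOver (λ z → δ a z 1 + ind (clockwise a z b))
len-as-sum a b = begin
    suc (count (λ z → clockwise a z b))
  ≡⟨ cong suc (count-as-sum (λ z → clockwise a z b)) ⟩
    suc (sumOver (λ z → ind (clockwise a z b)))
  ≡⟨ cong (_+ sumOver (λ z → ind (clockwise a z b))) (sum-δ a (λ _ → 1)) ⟨
    sumOver (λ z → δ a z 1) + sumOver (λ z → ind (clockwise a z b))
  ≡⟨ sum-+ (λ z → δ a z 1) (λ z → ind (clockwise a z b)) ⟨
    sumOver (λ z → δ a z 1 + ind (clockwise a z b)) ∎
  where open ≡-Reasoning

len-partition : ∀ {n} {u v : Fin n} → u ≢ v → len u v + len v u ≡ n
len-partition {n} {u} {v} u≢v = begin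
    len u v + len v u
  ≡⟨ cong₂ _+_ (len-as-sum u v) (len-as-sum v u) ⟩
    sumOver (λ z → δ u z 1 + ind (clockwise u z v)) + sumOver (λ z → δ v z 1 + ind (clockwise v z u))
  ≡⟨ sum-+ (λ z → δ u z 1 + ind (clockwise u z v)) (λ z → δ v z 1 + ind (clockwise v z u)) ⟨
    sumOver (λ z → (δ u z 1 + ind (clockwise u z v)) + (δ v z 1 + ind (clockwise v z u)))
  ≡⟨ sum-cong once ⟩
    sumOver {n} (λ _ → 1)
  ≡⟨ sum-ones ⟩
    n ∎
  where
  open ≡-Reasoning
  -- every vertex is u, v, or inside exactly one of the two arcs
  once : ∀ z → (δ u z 1 + ind (clockwise u z v)) + (δ v z 1 + ind (clockwise v z u)) ≡ 1
  once z with z ≟ u | z ≟ v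
  ... | yes refl | yes refl = ⊥-elim (u≢v refl)
  ... | yes refl | no  _    =
    cong₂ (λ x y → (1 + x) + (0 + y))
          (ind-false (λ t → cw-distinct (clockwise-sound z z v t) refl))
          (ind-false (λ t → cw-distinct₂ (clockwise-sound v z z t) refl))
  ... | no  _    | yes refl =
    cong₂ (λ x y → (0 + x) + (1 + y))
          (ind-false (λ t → cw-distinct₂ (clockwise-sound u z z t) refl))
          (ind-false (λ t → cw-distinct (clockwise-sound z z u t) refl))
  ... | no z≢u   | no z≢v with cw-total (z≢u ∘ sym) z≢v (u≢v ∘ sym)
  ...   | inj₁ uzv = cong₂ (λ x y → x + y) (ind-true (clockwise-complete uzv))
                           (ind-false (λ t → cw-exclusive uzv (clockwise-sound v z u t)))
  ...   | inj₂ vzu = cong₂ (λ x y → x + y) (ind-false (λ t → cw-exclusive vzu (clockwise-sound u z v t)))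
                           (ind-true (clockwise-complete vzu))

edge-len≤β : ∀ {n} (G : Digraph n) {a b} → T (G a b) → len a b ≤ β G
edge-len≤β G {a} {b} e =
  ≤-trans (entry (G a b) e)
          (≤-trans (max-ub (λ v → if G a v then len a v else 0) b)
                   (max-ub (λ u → maxOver (λ v → if G u v then len u v else 0)) a))
  where
  entry : ∀ x → T x → len a b ≤ (if x then len a b else 0)
  entry true _ = ≤-refl

longest-edge : ∀ {n} (G : Digraph n) → 0 < β G → ∃₂ λ u v → T (G u v) × len u v ≡ β G
longest-edge G β>0 =
  let (u , row≡β)     = max-attained (λ u → maxOver (λ v → if G u v then len u v else 0)) β>0
      (v , entry≡row) = max-attained (λ v → if G u v then len u v else 0) (subst (0 <_) (sym row≡β) β>0)
  in u , v , positive-entry (G u v) (trans entry≡row row≡β) β>0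
  where
  positive-entry : ∀ x {m k} → (if x then m else 0) ≡ k → 0 < k → T x × m ≡ k
  positive-entry true  m≡k _ = tt , m≡k
  positive-entry false refl ()

positive-sum : ∀ x {y} → 0 < x + y → 0 < x ⊎ 0 < y
positive-sum zero    pos = inj₂ pos
positive-sum (suc x) _   = inj₁ z<s

shorter-half : ∀ {x y n} → x + y ≡ n → n ≤ 2 * x → y ≤ x
shorter-half {x} {y} refl x+y≤2x =
  +-cancelˡ-≤ x y x (subst (x + y ≤_) (cong (x +_) (+-identityʳ x)) x+y≤2x)

exchange-balance : ∀ {p q c l} → p + c ≤ q + l → l ≤ c → q ≤ p → q ≡ p × c ≤ l
exchange-balance {p} {q} {c} {l} le l≤c q≤p =
  ≤-antisym q≤p (+-cancelʳ-≤ c p q (≤-trans le (+-monoʳ-≤ q l≤c))) ,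
  +-cancelˡ-≤ p c l (≤-trans le (+-monoˡ-≤ l q≤p))

-- Deleting a longest edge.

module DeleteLongestEdge {n} (G : Digraph n) (admG : Admissible G) {u v : Fin n}
  (Guv : T (G u v)) (longest : ∀ {a b} → T (G a b) → len a b ≤ len u v) where

  G-interval : ∀ {a b c} → Clockwise a b c → T (G a c) → T (G a b) × T (G b c)
  G-interval {a} {b} {c} cw = proj₂ (proj₂ admG) a b c (clockwise-complete cw)

  u≢v : u ≢ v
  u≢v refl = subst T (proj₁ admG u) Guv

  ¬Gvu : ¬ T (G v u)
  ¬Gvu = subst T (proj₁ (proj₂ admG) u v (neq⁺ u≢v) Guv)

  -- H is G without the edge uv.  It is used only through the lemmas of this
  -- block, which is why it is opaque: case splits on a ≟ u elsewhere must
  -- not rewrite its definition.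
  opaque
    H : Digraph n
    H a b = G a b ∧ not (⌊ a ≟ u ⌋ ∧ ⌊ b ≟ v ⌋)

    H-edge⁻ : ∀ {a b} → T (H a b) → T (G a b) × ¬ (a ≡ u × b ≡ v)
    H-edge⁻ {a} {b} h =
      let (g , t) = ∧⁻ (G a b) h in
      g , λ (a≡u , b≡v) →
        T-not⁻ _ t (∧⁺ (fromWitness {a? = a ≟ u} a≡u) (fromWitness {a? = b ≟ v} b≡v))

    H-edge⁺ : ∀ {a b} → T (G a b) → ¬ (a ≡ u × b ≡ v) → T (H a b)
    H-edge⁺ {a} {b} g ab≢uv =
      ∧⁺ g (T-not⁺ λ t →
        let (p , q) = ∧⁻ ⌊ a ≟ u ⌋ t in ab≢uv (toWitness {a? = a ≟ u} p , toWitness {a? = b ≟ v} q))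

    H-non-edge : ∀ {a b} → G a b ≡ false → H a b ≡ false
    H-non-edge {a} {b} = cong (λ x → x ∧ not (⌊ a ≟ u ⌋ ∧ ⌊ b ≟ v ⌋))

  uv-deleted : ¬ T (H u v)
  uv-deleted h = proj₂ (H-edge⁻ h) (refl , refl)

  -- Since uv is longest, no instance of the interval condition uses it.
  H-admissible : Admissible H
  H-admissible = loopless , two-free , interval
    where
    loopless : Loopless H
    loopless a = H-non-edge (proj₁ admG a)

    two-free : TwoFree H
    two-free a b a≢b h = H-non-edge (proj₁ (proj₂ admG) a b a≢b (proj₁ (H-edge⁻ h)))

    interval : CircularInterval H
    interval x y w t h =
      let Gxw = proj₁ (H-edge⁻ h)
          cw = clockwise-sound x y w t
          (Gxy , Gyw) = G-interval cw Gxw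
      in H-edge⁺ Gxy (λ (x≡u , y≡v) → <⇒≱ (len-mono-end cw) (longer x≡u y≡v Gxw))
       , H-edge⁺ Gyw (λ (y≡u , w≡v) → <⇒≱ (len-mono-start cw) (longer y≡u w≡v Gxw))
      where
      longer : ∀ {a b c d} → a ≡ u → b ≡ v → T (G c d) → len c d ≤ len a b
      longer refl refl = longest

  created : ∀ {b} → Clockwise u b v → Path3 H u b v
  created cw = record
    { a≢b = cw-distinct cw ; b≢c = cw-distinct₂ cw ; a≢c = u≢v
    ; ab  = H-edge⁺ (proj₁ (G-interval cw Guv)) (λ (_ , b≡v) → cw-distinct₂ cw b≡v)
    ; bc  = H-edge⁺ (proj₂ (G-interval cw Guv)) (λ (b≡u , _) → cw-distinct cw (sym b≡u))
    ; ¬ac = uv-deleted ; ¬ca = ¬Gvu ∘ proj₁ ∘ H-edge⁻ }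

  kept : ∀ {a b c} → Path3 G a b c → ¬ (a ≡ u × b ≡ v) → ¬ (b ≡ u × c ≡ v) → Path3 H a b c
  kept P ab≢uv bc≢uv = record
    { a≢b = a≢b ; b≢c = b≢c ; a≢c = a≢c
    ; ab = H-edge⁺ ab ab≢uv ; bc = H-edge⁺ bc bc≢uv
    ; ¬ac = ¬ac ∘ proj₁ ∘ H-edge⁻ ; ¬ca = ¬ca ∘ proj₁ ∘ H-edge⁻ }
    where open Path3 P

  kept-ind : ∀ a b c → ¬ (a ≡ u × b ≡ v) → ¬ (b ≡ u × c ≡ v) →
             ind (path? G a b c) ≤ ind (path? H a b c)
  kept-ind a b c ab≢uv bc≢uv =
    ind-mono (λ t → path-complete (kept (path-sound G a b c t) ab≢uv bc≢uv))

  lost : ℕ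
  lost = count (path? G u v) + count (λ a → path? G a u v)

  -- Triple-wise comparison of the induced paths of G and H: the created
  -- path u → b → v is weighted at (a, c) = (u, v), the lost paths at
  -- (a, b) = (u, v), resp. (b, c) = (u, v).
  exchange-at : ∀ a b c →
    ind (path? G a b c) + δ u a (δ v c (ind (clockwise a b c)))
      ≤ ind (path? H a b c) + (δ u a (δ v b (ind (path? G a b c))) + δ u b (δ v c (ind (path? G a b c))))
  exchange-at a b c with a ≟ u | b ≟ u | b ≟ v | c ≟ v
  -- (u, b, v) is created; it is no path of G as uv is an edge
  ... | yes refl | _        | _        | yes refl =
    ≤-trans (ind-disjoint (⊥-elim ∘ ¬uv) (path-complete ∘ created ∘ clockwise-sound u b v) (λ p _ → ¬uv p))
            (m≤m+n (ind (path? H u b v)) _)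
    where ¬uv = λ t → Path3.¬ac (path-sound G u b v t) Guv
  ... | yes refl | yes refl | yes u≡v  | no _     = ⊥-elim (u≢v u≡v)
  ... | yes refl | yes refl | no _     | no _     =
    +-monoˡ-≤ 0 (ind-mono (λ t → ⊥-elim (Path3.a≢b (path-sound G u u c t) refl)))
  ... | yes refl | no _     | yes refl | no _     = m≤n+m (ind (path? G u v c) + 0) (ind (path? H u v c))
  -- the remaining triples avoid uv and are kept, except the lost (a, u, v)
  ... | yes refl | no b≢u   | no b≢v   | no _     =
    +-monoˡ-≤ 0 (kept-ind u b c (b≢v ∘ proj₂) (b≢u ∘ proj₁))
  ... | no _     | yes refl | _        | yes refl =
    subst (_≤ ind (path? H a u v) + ind (path? G a u v)) (sym (+-identityʳ (ind (path? G a u v))))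
          (m≤n+m (ind (path? G a u v)) (ind (path? H a u v)))
  ... | no a≢u   | yes refl | _        | no c≢v   =
    +-monoˡ-≤ 0 (kept-ind a u c (a≢u ∘ proj₁) (c≢v ∘ proj₂))
  ... | no a≢u   | no b≢u   | _        | _        =
    +-monoˡ-≤ 0 (kept-ind a b c (a≢u ∘ proj₁) (b≢u ∘ proj₁))

  P3-exchange : P3 G + inner u v ≤ P3 H + lost
  P3-exchange = begin
      P3 G + inner u v
    ≡⟨ cong₂ _+_ (P3-as-Σ3 G)
                 (trans (count-as-sum (λ b → clockwise u b v)) (sym (Σ3-δ₁₃ u v created-at))) ⟩
      Σ3 pG + Σ3 (λ a b c → δ u a (δ v c (created-at a b c)))
    ≡⟨ Σ3-+ pG (λ a b c → δ u a (δ v c (created-at a b c))) ⟨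
      Σ3 (λ a b c → pG a b c + δ u a (δ v c (created-at a b c)))
    ≤⟨ Σ3-mono exchange-at ⟩
      Σ3 (λ a b c → pH a b c + (δ u a (δ v b (pG a b c)) + δ u b (δ v c (pG a b c))))
    ≡⟨ trans (Σ3-+ pH _) (cong (Σ3 pH +_) (Σ3-+ (λ a b c → δ u a (δ v b (pG a b c)))
                                                  (λ a b c → δ u b (δ v c (pG a b c))))) ⟩
      Σ3 pH + (Σ3 (λ a b c → δ u a (δ v b (pG a b c))) + Σ3 (λ a b c → δ u b (δ v c (pG a b c))))
    ≡⟨ cong₂ _+_ (sym (P3-as-Σ3 H))
                 (cong₂ _+_ (trans (Σ3-δ₁₂ u v pG) (sym (count-as-sum (path? G u v))))
                            (trans (Σ3-δ₂₃ u v pG) (sym (count-as-sum (λ a → path? G a u v))))) ⟩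
      P3 H + lost ∎
    where
    open ≤-Reasoning
    pG pH created-at : Fin n → Fin n → Fin n → ℕ
    pG a b c = ind (path? G a b c)
    pH a b c = ind (path? H a b c)
    created-at a b c = ind (clockwise a b c)

  lost-right-inside : ∀ {c} → Path3 G u v c → Clockwise v c u
  lost-right-inside P with cw-total (Path3.a≢c P) (Path3.b≢c P ∘ sym) (u≢v ∘ sym)
  ... | inj₂ vcu = vcu
  ... | inj₁ ucv = ⊥-elim (¬Gvu (proj₁ (G-interval (cw-rotate (cw-rotate ucv)) (Path3.bc P))))

  lost-left-inside : ∀ {a} → Path3 G a u v → Clockwise v a u
  lost-left-inside P with cw-total (Path3.a≢b P ∘ sym) (Path3.a≢c P) (u≢v ∘ sym)
  ... | inj₂ vau = vau
  ... | inj₁ uav = ⊥-elim (¬Gvu (proj₂ (G-interval (cw-rotate uav) (Path3.ab P))))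

  -- The two kinds of lost paths have distinct third vertices inside the arc v→u.
  lost≤inner : lost ≤ inner v u
  lost≤inner =
    count-disjoint (λ c t → clockwise-complete (lost-right-inside (path-sound G u v c t)))
                   (λ a t → clockwise-complete (lost-left-inside (path-sound G a u v t)))
                   (λ z t t′ → Path3.¬ca (path-sound G u v z t) (Path3.ab (path-sound G z u v t′)))

  lost-nonedge : 0 < lost → ∃₂ λ c d → T (nonEdge G c d) × len c d < len v u
  lost-nonedge pos with positive-sum (count (path? G u v)) pos
  ... | inj₁ right =
    let (c , t) = count-witness (path? G u v) right
        P = path-sound G u v c t
    in c , u , nonEdge⁺ G (Path3.a≢c P ∘ sym) (Path3.¬ca P) (Path3.¬ac P)
     , len-mono-start (lost-right-inside P)
  ... | inj₂ left =
    let (a , t) = count-witness (λ a → path? G a u v) left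
        P = path-sound G a u v t
    in v , a , nonEdge⁺ G (Path3.a≢c P ∘ sym) (Path3.¬ca P) (Path3.¬ac P)
     , len-mono-end (lost-left-inside P)

  H-short-nonedge : ∀ {c d} → T (nonEdge H c d) → len c d < len u v → len c d < len v u → T (nonEdge G c d)
  H-short-nonedge {c} {d} ne cd<uv cd<vu =
    let (c≢d , ¬Hcd , ¬Hdc) = nonEdge⁻ H c d ne in
    nonEdge⁺ G c≢d (λ g → ¬Hcd (H-edge⁺ g λ (c≡u , d≡v) → <-irrefl (cong₂ len c≡u d≡v) cd<uv))
                   (λ g → ¬Hdc (H-edge⁺ g λ (d≡u , c≡v) → <-irrefl (cong₂ len c≡v d≡u) cd<vu))

  ξ-pair-kept : len u v ≤ len v u → ∀ {a b c d} → T (shorter? H a b c d) → T (shorter? G a b c d)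
  ξ-pair-kept uv≤vu {a} {b} {c} {d} t =
    let (Hab , t₁) = ∧⁻ (H a b) t
        (ne , lt) = ∧⁻ (nonEdge H c d) t₁
        Gab = proj₁ (H-edge⁻ Hab)
        cd<uv = <-≤-trans (<ᵇ⇒< (len c d) (len a b) lt) (longest Gab)
    in ∧⁺ Gab (∧⁺ (H-short-nonedge ne cd<uv (<-≤-trans cd<uv uv≤vu)) lt)

  ξ-decrease : len u v ≤ len v u → ∀ {c d} → T (nonEdge G c d) → len c d < len u v → ξ H < ξ G
  ξ-decrease uv≤vu {c} {d} ne cd<uv =
    Σ3-strict (λ a b x → count-mono (λ y → ξ-pair-kept uv≤vu {a} {b} {x} {y})) u v c
      (count-strict (λ y → ξ-pair-kept uv≤vu {u} {v} {c} {y}) d (uv-deleted ∘ proj₁ ∘ ∧⁻ (H u v))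
                    (∧⁺ Guv (∧⁺ ne (<⇒<ᵇ cd<uv))))

-- In an optimal digraph on n ≥ 4 vertices no longest edge uv spans half the
-- circle: otherwise deleting uv keeps P̃₃ but decreases ξ.
no-half-long-edge : ∀ {n} (G : Digraph n) → Optimal G → 4 ≤ n →
                    ∀ {u v} → T (G u v) → (∀ {a b} → T (G a b) → len a b ≤ len u v) →
                    n ≤ 2 * len u v → ⊥
no-half-long-edge G (admG , P3-max , ξ-min) 4≤n {u} {v} Guv longest n≤2uv =
  let (c , d , cd-nonedge , cd<vu) = lost-nonedge lost-positive in
  <⇒≱ (ξ-decrease uv≤vu cd-nonedge (<-≤-trans cd<vu vu≤uv)) (ξ-min H H-admissible P3H≡P3G)
  where
  open DeleteLongestEdge G admG Guv longest
  vu≤uv : len v u ≤ len u v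
  vu≤uv = shorter-half (len-partition u≢v) n≤2uv
  -- so H gains at least as many induced paths as it loses; optimality makes this tight
  balance : P3 H ≡ P3 G × inner u v ≤ lost
  balance = exchange-balance P3-exchange (≤-trans lost≤inner (≤-pred vu≤uv)) (P3-max H H-admissible)
  P3H≡P3G : P3 H ≡ P3 G
  P3H≡P3G = proj₁ balance
  uv≤vu : len u v ≤ len v u
  uv≤vu = s≤s (≤-trans (proj₂ balance) lost≤inner)
  -- and, as len u v ≥ 2, some induced path is lost
  lost-positive : 0 < lost
  lost-positive = ≤-trans (≤-pred (*-cancelˡ-≤ 2 (≤-trans 4≤n n≤2uv))) (proj₂ balance)

-- Lemma 3.4: 2 β_G < n.  A longest edge exists once 2 β_G ≥ n ≥ 4, and
-- it would span half the circle.
lemma3p4 : (n : ℕ) → 4 ≤ n → (G : Digraph n) → Optimal G → 2 * β G < n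
lemma3p4 n 4≤n G opt = ≰⇒> λ n≤2β →
  let (u , v , Guv , len≡β) = longest-edge G (positive (≤-trans 4≤n n≤2β))
  in no-half-long-edge G opt 4≤n Guv
       (λ e → subst (_ ≤_) (sym len≡β) (edge-len≤β G e))
       (subst (λ m → n ≤ 2 * m) (sym len≡β) n≤2β)
  where
  positive : ∀ {m} → 4 ≤ 2 * m → 0 < m
  positive {zero}  ()
  positive {suc m} _ = z<s
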